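{- The hypergraph $\mathcal{H}$ defined below is linear, i.e. any two distinct edges of $\mathcal{H}$ intersect in at most one vertex.
   Context: Let $q$ be a power of an odd prime, and let $r \geq 2$ and $l \geq 1$ be integers. Let $\alpha_1, \dots, \alpha_r$ be distinct elements of $\mathbb{F}_q$, and let $m_1, \dots, m_l$ be distinct elements of $\mathbb{F}_q^* = \mathbb{F}_q \setminus\{0\}$ such that $m_s(\alpha_k - \alpha_i) \neq m_t(\alpha_k - \alpha_j)$ whenever $1 \leq s, t \leq l$ and $i, j, k$ are distinct integers in $\{1, \dots, r\}$. For $1 \leq i \leq r$ let $V_i = \mathbb{F}_q \times \mathbb{F}_q \times \{i\}$. For $x, y \in \mathbb{F}_q$, $a \in \mathbb{F}_q^*$ and $s \in \{1, \dots, l\}$, let \[ e(x,y,a,m_s) = \{ (x + \alpha_i m_s a,\; y + \alpha_i m_s a^2,\; i) : 1 \leq i \leq r \}. \] $\mathcal{H}$ is the $r$-uniform hypergraph with vertex set $V_1 \cup \dots \cup V_r$ and edge set $\{ e(x,y,a,m_s) : x,y \in \mathbb{F}_q,\ a \in \mathbb{F}_q^*,\ 1 \leq s \leq l\}$. -}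

module Defs where

open import Level using (0ℓ)
open import Algebra.Bundles using (CommutativeRing)
open import Data.Nat using (ℕ; _≤_; _^_)
open import Data.Nat.Primality using (Prime)
open import Data.Fin using (Fin)
open import Data.Product using (Σ; ∃; _×_; _,_)
open import Relation.Nullary using (¬_)
open import Relation.Binary.PropositionalEquality using (_≡_; _≢_)

IsOddPrimePower : ℕ → Set
IsOddPrimePower q = Σ ℕ λ p → Σ ℕ λ k → Prime p × p ≢ 2 × 1 ≤ k × q ≡ p ^ k

module _ (R : CommutativeRing 0ℓ 0ℓ) where
  open CommutativeRing R

  IsField : Set
  IsField = (¬ (1# ≈ 0#)) × (∀ x → ¬ (x ≈ 0#) → Σ Carrier λ y → x * y ≈ 1#)

  HasCardinality : ℕ → Set
  HasCardinality q = Σ (Fin q → Carrier) λ f →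
    (∀ i j → f i ≈ f j → i ≡ j) × (∀ x → Σ (Fin q) λ i → f i ≈ x)

  IsFiniteFieldOfOrder : ℕ → Set
  IsFiniteFieldOfOrder q = IsField × HasCardinality q × IsOddPrimePower q

module Hypergraph (R : CommutativeRing 0ℓ 0ℓ) (r l : ℕ)
                  (α : Fin r → CommutativeRing.Carrier R)
                  (m : Fin l → CommutativeRing.Carrier R) where
  open CommutativeRing R

  -- vertices: V_1 ∪ … ∪ V_r with V_i = F × F × {i}
  Vertex : Set
  Vertex = Carrier × Carrier × Fin r

  _≈V_ : Vertex → Vertex → Set
  (x , y , i) ≈V (x' , y' , i') = x ≈ x' × y ≈ y' × i ≡ i'

  record EdgeParam : Set where
    constructor edge
    field
      ex : Carrier
      ey : Carrier
      ea : Carrier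
      ea≠0 : ¬ (ea ≈ 0#)
      es : Fin l

  -- membership of a vertex in e(x,y,a,m_s) =
  --   { (x + α_i m_s a, y + α_i m_s a², i) : 1 ≤ i ≤ r }
  _∈E_ : Vertex → EdgeParam → Set
  (u₁ , u₂ , i) ∈E edge x y a _ s =
    (u₁ ≈ x + α i * m s * a) × (u₂ ≈ y + α i * m s * (a * a))

  -- two edges are the same edge iff they have the same vertex set
  SameEdge : EdgeParam → EdgeParam → Set
  SameEdge e e' = ∀ v → ((v ∈E e → v ∈E e') × (v ∈E e' → v ∈E e))

  IsLinear : Set
  IsLinear = ∀ e e' → ¬ SameEdge e e' →
    ∀ u w → u ∈E e → u ∈E e' → w ∈E e → w ∈E e' → u ≈V w

module Submission where

-- A vertex (u₁, u₂, i) lies on the edge e(x, y, a, m_s) exactly when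
-- u₁ = x + α_i·(m_s a) and u₂ = y + α_i·(m_s a²): in each coordinate the edge
-- is the graph of an affine function t ↦ x + t·c, sampled at t = α_i.
-- Let two edges share the vertices u ∈ V_i and w ∈ V_j.
--   * If i = j, both vertices are the vertex of the first edge in V_i, so u = w.
--   * If i ≠ j, then α_i ≠ α_j, and in each coordinate the affine functions of
--     the two edges agree at two distinct points; over a field they then have
--     the same slope and intercept: m_s a = m_t a', m_s a² = m_t a'², x = x',
--     y = y'. Dividing the second slope by the first gives a = a', hence
--     m_s = m_t, so the edges have equal parameters and the same vertex set,
--     contradicting their distinctness.

open import Defs
open import Level using (0ℓ)
open import Algebra.Bundles using (CommutativeRing)
open import Data.Nat using (ℕ; _≤_)
open import Data.Fin using (Fin)
open import Data.Fin.Properties using (_≟_)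
open import Data.Product using (Σ; _×_; _,_; proj₁; proj₂)
open import Data.Empty using (⊥-elim)
open import Relation.Nullary using (¬_; yes; no)
open import Relation.Binary.PropositionalEquality using (_≡_; _≢_; refl)
import Relation.Binary.Reasoning.Setoid as SetoidReasoning

module FieldFacts (R : CommutativeRing 0ℓ 0ℓ)
  (inverse : ∀ x → ¬ (CommutativeRing._≈_ R x (CommutativeRing.0# R)) →
               Σ (CommutativeRing.Carrier R) λ y →
                 CommutativeRing._≈_ R (CommutativeRing._*_ R x y) (CommutativeRing.1# R))
  where
  open CommutativeRing R
  open SetoidReasoning setoid
  open import Algebra.Properties.Ring ring using ([y-z]x≈yx-zx)
  open import Algebra.Properties.AbelianGroup +-abelianGroup using (⁻¹-∙-comm)
  open import Algebra.Properties.CommutativeSemigroup +-commutativeSemigroup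
    using (interchange)
  open import Algebra.Properties.Group +-group using (x∙y⁻¹≈ε⇒x≈y; quasigroup)
  open import Algebra.Properties.Quasigroup quasigroup using (cancelʳ)

  *-cancelˡ-nonzero : ∀ {c y z} → ¬ c ≈ 0# → c * y ≈ c * z → y ≈ z
  *-cancelˡ-nonzero {c} {y} {z} c≉0 cy≈cz with inverse c c≉0
  ... | d , cd≈1 = begin
    y             ≈⟨ *-identityˡ y ⟨
    1# * y        ≈⟨ *-congʳ cd≈1 ⟨
    (c * d) * y   ≈⟨ d-times y ⟩
    d * (c * y)   ≈⟨ *-congˡ cy≈cz ⟩
    d * (c * z)   ≈⟨ d-times z ⟨
    (c * d) * z   ≈⟨ *-congʳ cd≈1 ⟩
    1# * z        ≈⟨ *-identityˡ z ⟩
    z             ∎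
    where
    d-times : ∀ v → (c * d) * v ≈ d * (c * v)
    d-times v = trans (*-congʳ (*-comm c d)) (*-assoc d c v)

  *-nonzero : ∀ {x y} → ¬ x ≈ 0# → ¬ y ≈ 0# → ¬ x * y ≈ 0#
  *-nonzero {x} x≉0 y≉0 xy≈0 = y≉0 (*-cancelˡ-nonzero x≉0 (trans xy≈0 (sym (zeroʳ x))))

  affine-difference : ∀ x p q c → (x + p * c) - (x + q * c) ≈ (p - q) * c
  affine-difference x p q c = begin
    (x + p * c) + - (x + q * c)     ≈⟨ +-congˡ (⁻¹-∙-comm x (q * c)) ⟨
    (x + p * c) + (- x + - (q * c)) ≈⟨ interchange x (p * c) (- x) (- (q * c)) ⟩
    (x - x) + (p * c - q * c)       ≈⟨ +-congʳ (-‿inverseʳ x) ⟩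
    0# + (p * c - q * c)            ≈⟨ +-identityˡ _ ⟩
    p * c - q * c                   ≈⟨ [y-z]x≈yx-zx c p q ⟨
    (p - q) * c                     ∎

  affine-determined : ∀ {x x' c c' p q} → ¬ p ≈ q →
    x + p * c ≈ x' + p * c' → x + q * c ≈ x' + q * c' → c ≈ c' × x ≈ x'
  affine-determined {x} {x'} {c} {c'} {p} {q} p≉q at-p at-q = slopes , intercepts
    where
    slopes : c ≈ c'
    slopes = *-cancelˡ-nonzero (λ p-q≈0 → p≉q (x∙y⁻¹≈ε⇒x≈y p q p-q≈0)) (begin
      (p - q) * c                   ≈⟨ affine-difference x p q c ⟨
      (x + p * c) - (x + q * c)     ≈⟨ +-cong at-p (-‿cong at-q) ⟩
      (x' + p * c') - (x' + q * c') ≈⟨ affine-difference x' p q c' ⟩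
      (p - q) * c'                  ∎)
    intercepts : x ≈ x'
    intercepts = cancelʳ (p * c) x x' (trans at-p (+-congˡ (*-congˡ (sym slopes))))

  -- For m, a ≠ 0 the pair (m, a) is recovered from m·a and m·a², since
  -- a = (m·a²)/(m·a) and then m = (m·a)/a.
  scale-and-square-determined : ∀ {m m' a a'} → ¬ m ≈ 0# → ¬ a ≈ 0# →
    m * a ≈ m' * a' → m * (a * a) ≈ m' * (a' * a') → a ≈ a' × m ≈ m'
  scale-and-square-determined {m} {m'} {a} {a'} m≉0 a≉0 ma≈ ma²≈ = a≈a' , m≈m'
    where
    a≈a' : a ≈ a'
    a≈a' = *-cancelˡ-nonzero (*-nonzero m≉0 a≉0) (begin
      (m * a) * a     ≈⟨ *-assoc m a a ⟩
      m * (a * a)     ≈⟨ ma²≈ ⟩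
      m' * (a' * a')  ≈⟨ *-assoc m' a' a' ⟨
      (m' * a') * a'  ≈⟨ *-congʳ ma≈ ⟨
      (m * a) * a'    ∎)
    m≈m' : m ≈ m'
    m≈m' = *-cancelˡ-nonzero a≉0 (begin
      a * m    ≈⟨ *-comm a m ⟩
      m * a    ≈⟨ ma≈ ⟩
      m' * a'  ≈⟨ *-congˡ a≈a' ⟨
      m' * a   ≈⟨ *-comm m' a ⟩
      a * m'   ∎)

module Linearity (R : CommutativeRing 0ℓ 0ℓ)
  (inverse : ∀ x → ¬ (CommutativeRing._≈_ R x (CommutativeRing.0# R)) →
               Σ (CommutativeRing.Carrier R) λ y →
                 CommutativeRing._≈_ R (CommutativeRing._*_ R x y) (CommutativeRing.1# R))
  (r l : ℕ)
  (α : Fin r → CommutativeRing.Carrier R)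
  (α-injective : ∀ i j → CommutativeRing._≈_ R (α i) (α j) → i ≡ j)
  (m : Fin l → CommutativeRing.Carrier R)
  (m-nonzero : ∀ s → ¬ CommutativeRing._≈_ R (m s) (CommutativeRing.0# R))
  where
  open CommutativeRing R hiding (refl)
  open FieldFacts R inverse
  open Hypergraph R r l α m

  -- Two edge parameters describe the same edge up to ≈ (m_s is compared, not s).
  EquivalentParams : EdgeParam → EdgeParam → Set
  EquivalentParams (edge x y a _ s) (edge x' y' a' _ t) =
    x ≈ x' × y ≈ y' × a ≈ a' × m s ≈ m t

  ∈E-respects : ∀ e e' → EquivalentParams e e' → ∀ v → v ∈E e → v ∈E e'
  ∈E-respects (edge _ _ _ _ _) (edge _ _ _ _ _) (x≈ , y≈ , a≈ , m≈) (_ , _ , _)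
    (u₁≈ , u₂≈) =
      trans u₁≈ (+-cong x≈ (*-cong (*-congˡ m≈) a≈))
    , trans u₂≈ (+-cong y≈ (*-cong (*-congˡ m≈) (*-cong a≈ a≈)))

  equivalentParams-sym : ∀ e e' → EquivalentParams e e' → EquivalentParams e' e
  equivalentParams-sym (edge _ _ _ _ _) (edge _ _ _ _ _) (x≈ , y≈ , a≈ , m≈) =
    sym x≈ , sym y≈ , sym a≈ , sym m≈

  equivalentParams⇒SameEdge : ∀ e e' → EquivalentParams e e' → SameEdge e e'
  equivalentParams⇒SameEdge e e' e~e' v =
    ∈E-respects e e' e~e' v , ∈E-respects e' e (equivalentParams-sym e e' e~e') v

  same-part⇒same-vertex : ∀ e {u₁ u₂ w₁ w₂ i} →
    (u₁ , u₂ , i) ∈E e → (w₁ , w₂ , i) ∈E e → (u₁ , u₂ , i) ≈V (w₁ , w₂ , i)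
  same-part⇒same-vertex (edge _ _ _ _ _) (u₁≈ , u₂≈) (w₁≈ , w₂≈) =
    trans u₁≈ (sym w₁≈) , trans u₂≈ (sym w₂≈) , refl

  common-value : ∀ {u x x' p n n' a a'} →
    u ≈ x + p * n * a → u ≈ x' + p * n' * a' → x + p * (n * a) ≈ x' + p * (n' * a')
  common-value {p = p} {n} {n'} {a} {a'} u≈ u≈' =
    trans (+-congˡ (sym (*-assoc p n a)))
      (trans (trans (sym u≈) u≈') (+-congˡ (*-assoc p n' a')))

  two-common-vertices⇒equivalentParams : ∀ e e' {u₁ u₂ w₁ w₂ i j} → i ≢ j →
    (u₁ , u₂ , i) ∈E e → (u₁ , u₂ , i) ∈E e' →
    (w₁ , w₂ , j) ∈E e → (w₁ , w₂ , j) ∈E e' → EquivalentParams e e'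
  two-common-vertices⇒equivalentParams (edge x y a a≉0 s) (edge x' y' a' _ t)
    {i = i} {j} i≢j (u₁≈ , u₂≈) (u₁≈' , u₂≈') (w₁≈ , w₂≈) (w₁≈' , w₂≈') =
    proj₂ first , proj₂ second , recovered
    where
    αi≉αj : ¬ α i ≈ α j
    αi≉αj αi≈αj = i≢j (α-injective i j αi≈αj)
    first : m s * a ≈ m t * a' × x ≈ x'
    first = affine-determined αi≉αj (common-value u₁≈ u₁≈') (common-value w₁≈ w₁≈')
    second : m s * (a * a) ≈ m t * (a' * a') × y ≈ y'
    second = affine-determined αi≉αj (common-value u₂≈ u₂≈') (common-value w₂≈ w₂≈')
    recovered : a ≈ a' × m s ≈ m t
    recovered = scale-and-square-determined (m-nonzero s) a≉0 (proj₁ first) (proj₁ second)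

  isLinear : IsLinear
  isLinear e e' e≠e' (_ , _ , i) (_ , _ , j) u∈e u∈e' w∈e w∈e' with i ≟ j
  ... | yes refl = same-part⇒same-vertex e u∈e w∈e
  ... | no i≢j = ⊥-elim (e≠e' (equivalentParams⇒SameEdge e e'
         (two-common-vertices⇒equivalentParams e e' i≢j u∈e u∈e' w∈e w∈e')))

-- Lemma 3.5: H is linear.
lemma3p5 : (R : CommutativeRing 0ℓ 0ℓ) (q : ℕ) → IsFiniteFieldOfOrder R q →
    (r l : ℕ) → 2 ≤ r → 1 ≤ l →
    (α : Fin r → CommutativeRing.Carrier R) →
    (∀ i j → CommutativeRing._≈_ R (α i) (α j) → i ≡ j) →
    (m : Fin l → CommutativeRing.Carrier R) →
    (∀ s t → CommutativeRing._≈_ R (m s) (m t) → s ≡ t) →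
    (∀ s → ¬ CommutativeRing._≈_ R (m s) (CommutativeRing.0# R)) →
    (∀ s t (i j k : Fin r) → i ≢ j → i ≢ k → j ≢ k →
    ¬ CommutativeRing._≈_ R
    (CommutativeRing._*_ R (m s) (CommutativeRing._-_ R (α k) (α i)))
    (CommutativeRing._*_ R (m t) (CommutativeRing._-_ R (α k) (α j)))) →
    Hypergraph.IsLinear R r l α m
lemma3p5 R _ ((_ , inverse) , _) r l _ _ α α-injective m _ m-nonzero _ =
  Linearity.isLinear R inverse r l α α-injective m m-nonzero
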